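{- Let $m$ be the maximal number of vertices of the $600$-cell that can be chosen so that any two chosen vertices are at distance at least $3$ in the $1$-skeleton of the $600$-cell (whose graph has diameter $5$). Then $6\le m\le 9$.
   Context: The $600$-cell is the regular $4$-polytope with Schläfli symbol $\{3,3,5\}$; it has $120$ vertices, each with $12$ neighbours in its $1$-skeleton. -}

module Defs where

open import Data.Nat using (ℕ)
open import Data.Integer as ℤ using (ℤ; +_; -[1+_])
open import Data.Product using (Σ; _×_; _,_; ∃)
open import Data.List using (List; []; _∷_; _++_; concatMap; map; length)
open import Data.List.Relation.Unary.AllPairs using (AllPairs)
open import Data.Fin using (Fin)
open import Data.Vec as Vec using (Vec; fromList; lookup)
open import Relation.Binary.PropositionalEquality using (_≡_; refl)
open import Relation.Nullary using (¬_)

-- The ring ℤ[φ], φ = golden ratio, φ² = φ + 1.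
-- A pair (a , b) represents a + b φ.

ℤφ : Set
ℤφ = ℤ × ℤ

infixl 6 _+φ_
infixl 7 _*φ_

_+φ_ : ℤφ → ℤφ → ℤφ
(a , b) +φ (c , d) = (a ℤ.+ c , b ℤ.+ d)

_*φ_ : ℤφ → ℤφ → ℤφ
(a , b) *φ (c , d) = (a ℤ.* c ℤ.+ b ℤ.* d , a ℤ.* d ℤ.+ b ℤ.* c ℤ.+ b ℤ.* d)

negφ : ℤφ → ℤφ
negφ (a , b) = (ℤ.- a , ℤ.- b)

0φ 1φ 2φ φ φ⁻¹ : ℤφ
0φ  = (+ 0 , + 0)
1φ  = (+ 1 , + 0)
2φ  = (+ 2 , + 0)
φ   = (+ 0 , + 1)
φ⁻¹ = (-[1+ 0 ] , + 1)   -- φ - 1 = 1/φ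

-- Points of ℝ⁴ with coordinates in ℤ[φ]; the 600-cell vertices are
-- stored scaled by a factor 2 (so they lie on the sphere of radius 2).

P4 : Set
P4 = ℤφ × ℤφ × ℤφ × ℤφ

dot : P4 → P4 → ℤφ
dot (a₀ , a₁ , a₂ , a₃) (b₀ , b₁ , b₂ , b₃) =
  a₀ *φ b₀ +φ a₁ *φ b₁ +φ a₂ *φ b₂ +φ a₃ *φ b₃

signs : ℤφ → List ℤφ
signs x = x ∷ negφ x ∷ []

family₁ : List P4
family₁ = concatMap (λ s → (s , 0φ , 0φ , 0φ) ∷ (0φ , s , 0φ , 0φ)
                         ∷ (0φ , 0φ , s , 0φ) ∷ (0φ , 0φ , 0φ , s) ∷ [])
                    (signs 2φ)

family₂ : List P4
family₂ = concatMap (λ a → concatMap (λ b → concatMap (λ c → map (λ d → (a , b , c , d))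
            (signs 1φ)) (signs 1φ)) (signs 1φ)) (signs 1φ)

evenPerms : ℤφ → ℤφ → ℤφ → ℤφ → List P4
evenPerms x₀ x₁ x₂ x₃ =
    (x₀ , x₁ , x₂ , x₃) ∷ (x₀ , x₂ , x₃ , x₁) ∷ (x₀ , x₃ , x₁ , x₂)
  ∷ (x₁ , x₀ , x₃ , x₂) ∷ (x₁ , x₂ , x₀ , x₃) ∷ (x₁ , x₃ , x₂ , x₀)
  ∷ (x₂ , x₀ , x₁ , x₃) ∷ (x₂ , x₁ , x₃ , x₀) ∷ (x₂ , x₃ , x₀ , x₁)
  ∷ (x₃ , x₀ , x₂ , x₁) ∷ (x₃ , x₁ , x₀ , x₂) ∷ (x₃ , x₂ , x₁ , x₀) ∷ []

family₃ : List P4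
family₃ = concatMap (λ a → concatMap (λ b → concatMap (λ c → evenPerms a b c 0φ)
            (signs φ⁻¹)) (signs 1φ)) (signs φ)

vertexList : List P4
vertexList = family₁ ++ family₂ ++ family₃

vertexCount : length vertexList ≡ 120
vertexCount = refl

Vertex : Set
Vertex = Fin (length vertexList)

pos : Vertex → P4
pos v = lookup (fromList vertexList) v

-- Edge length of the unit-radius 600-cell is 1/φ; two vertices u, v are
-- adjacent iff ⟨u,v⟩ = φ/2, i.e. for the scaled points ⟨2u,2v⟩ = 2φ.
Adj : Vertex → Vertex → Set
Adj u v = dot (pos u) (pos v) ≡ (+ 0 , + 2)

DistAtLeast3 : Vertex → Vertex → Set
DistAtLeast3 u v = ¬ (u ≡ v) × ¬ Adj u v × ¬ (∃ λ w → Adj u w × Adj w v)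

IsDist3Set : List Vertex → Set
IsDist3Set S = AllPairs DistAtLeast3 S

{-# OPTIONS --safe #-}
-- If u and v are at distance at least 3, their closed neighbourhoods are
-- disjoint. In the 12-regular 600-cell every closed neighbourhood has 13
-- vertices, so m disjoint ones fit among 120 vertices only if 13 m ≤ 120,
-- i.e. m ≤ 9. For the lower bound, the six vertices ±2e₁, ±2e₂, 2e₃, 2e₄ are
-- pairwise orthogonal or antipodal, and checking shows they are pairwise at
-- distance at least 3.
module Submission where

open import Defs
open import Data.Nat using (_≤_)
open import Data.List using (List; length)
open import Data.Product using (Σ; _×_)
open import Relation.Binary.PropositionalEquality using (_≡_)

open import Level using (Level)
open import Function using (_∘_; id; _⇔_; mk⇔)
open import Function.Definitions using (Injective)
open import Data.Bool using (true; false)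
open import Data.Empty using (⊥-elim)
open import Data.Nat as ℕ using (ℕ; suc; z≤n; s≤s)
open import Data.Nat.Properties as ℕ
  using (≤-trans; ≤-reflexive; ≤-<-trans; ≤-pred; +-mono-≤; *-cancelʳ-<; <ᵇ⇒<)
open import Data.Integer as ℤ using (+_)
import Data.Integer.Properties as ℤ
open import Data.Fin as Fin using (Fin; zero; suc; #_)
open import Data.Fin.Properties using (injective⇒≤)
open import Data.List as List using ([]; _∷_; map; filter; allFin; concatMap; tabulate)
open import Data.List.Properties using (length-++; length-map; map-tabulate)
open import Data.List.Membership.Propositional using (_∈_)
open import Data.List.Membership.Propositional.Properties using (∈-lookup; ∈-filter⁻)
open import Data.List.Relation.Unary.All as All using (All; []; _∷_)
import Data.List.Relation.Unary.All.Properties as All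
open import Data.List.Relation.Unary.Any using (here; there)
open import Data.List.Relation.Unary.AllPairs as AllPairs using (AllPairs; []; _∷_; allPairs?)
import Data.List.Relation.Unary.AllPairs.Properties as AllPairs
open import Data.List.Relation.Unary.Unique.Propositional using (Unique)
import Data.List.Relation.Unary.Unique.Propositional.Properties as Unique
open import Data.List.Relation.Binary.Disjoint.Propositional using (Disjoint)
import Data.Vec as Vec
import Data.Vec.Relation.Unary.All.Properties as VecAll
open import Data.Product using (∃; _,_; proj₂; curry; uncurry)
open import Data.Product.Properties using (≡-dec)
open import Data.Sum using (_⊎_; inj₁; inj₂)
open import Data.Unit using (tt)
open import Relation.Binary using (Rel; Decidable; DecidableEquality; Symmetric)
open import Relation.Binary.PropositionalEquality using (refl; sym; trans; cong; cong₂; module ≡-Reasoning)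
open import Relation.Nullary using (¬_; Dec; does; ¬?; _×-dec_)
import Relation.Nullary.Decidable as Dec
open import Relation.Nullary.Decidable using (toWitness)
open import Relation.Unary as U using (Pred)

Unique⇒lookup-injective : ∀ {a} {A : Set a} {xs : List A} → Unique xs → Injective _≡_ _≡_ (List.lookup xs)
Unique⇒lookup-injective (_  ∷ _) {zero}  {zero}  _  = refl
Unique⇒lookup-injective (x∉ ∷ _) {zero}  {suc j} eq = ⊥-elim (All.lookup x∉ (∈-lookup j) eq)
Unique⇒lookup-injective (x∉ ∷ _) {suc i} {zero}  eq = ⊥-elim (All.lookup x∉ (∈-lookup i) (sym eq))
Unique⇒lookup-injective (_  ∷ u) {suc i} {suc j} eq = cong suc (Unique⇒lookup-injective u eq)

Unique⇒length≤ : ∀ {n} {xs : List (Fin n)} → Unique xs → length xs ≤ n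
Unique⇒length≤ u = injective⇒≤ (Unique⇒lookup-injective u)

module Packing {n : ℕ} {ℓ : Level} (_~_ : Rel (Fin n) ℓ) (_~?_ : Decidable _~_)
               (~-sym : Symmetric _~_) (~-irrefl : ∀ v → ¬ v ~ v) where

  Distance≥3 : Rel (Fin n) ℓ
  Distance≥3 u v = ¬ u ≡ v × ¬ u ~ v × ¬ ∃ λ w → u ~ w × w ~ v

  neighbours : Fin n → List (Fin n)
  neighbours v = filter (v ~?_) (allFin n)

  degree : Fin n → ℕ
  degree = length ∘ neighbours

  ball : Fin n → List (Fin n)
  ball v = v ∷ neighbours v

  ∈-neighbours⁻ : ∀ {v w} → w ∈ neighbours v → v ~ w
  ∈-neighbours⁻ {v} w∈N = proj₂ (∈-filter⁻ (v ~?_) {xs = allFin n} w∈N)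

  ∈-ball⁻ : ∀ {v w} → w ∈ ball v → v ≡ w ⊎ v ~ w
  ∈-ball⁻ (here w≡v)  = inj₁ (sym w≡v)
  ∈-ball⁻ (there w∈N) = inj₂ (∈-neighbours⁻ w∈N)

  ball-unique : ∀ v → Unique (ball v)
  ball-unique v = All.tabulate (λ { w∈N refl → ~-irrefl v (∈-neighbours⁻ w∈N) })
                ∷ Unique.filter⁺ (v ~?_) (Unique.allFin⁺ n)

  distance≥3⇒disjoint-balls : ∀ {u v} → Distance≥3 u v → Disjoint (ball u) (ball v)
  distance≥3⇒disjoint-balls (u≢v , u≁v , no-path) (w∈Bu , w∈Bv) with ∈-ball⁻ w∈Bu | ∈-ball⁻ w∈Bv
  ... | inj₁ refl | inj₁ refl = u≢v refl
  ... | inj₁ refl | inj₂ v~u  = u≁v (~-sym v~u)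
  ... | inj₂ u~w  | inj₁ refl = u≁v u~w
  ... | inj₂ u~w  | inj₂ v~w  = no-path (_ , u~w , ~-sym v~w)

  distance≥3⇒balls-unique : ∀ {S} → AllPairs Distance≥3 S → Unique (concatMap ball S)
  distance≥3⇒balls-unique dist3 = Unique.concat⁺
    (All.map⁺ (All.tabulate λ {v} _ → ball-unique v))
    (AllPairs.map⁺ (AllPairs.map distance≥3⇒disjoint-balls dist3))

  length-balls≥ : ∀ {d} → (∀ v → d ≤ degree v) → ∀ S → length S ℕ.* suc d ≤ length (concatMap ball S)
  length-balls≥ δ []      = z≤n
  length-balls≥ δ (v ∷ S) = ≤-trans (+-mono-≤ (s≤s (δ v)) (length-balls≥ δ S))
                                    (≤-reflexive (sym (length-++ (ball v))))

  packing-bound : ∀ {d} → (∀ v → d ≤ degree v) → ∀ {S} → AllPairs Distance≥3 S → length S ℕ.* suc d ≤ n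
  packing-bound δ {S} dist3 = ≤-trans (length-balls≥ δ S) (Unique⇒length≤ (distance≥3⇒balls-unique dist3))

module _ {a b p} {A : Set a} {B : Set b} {P : Pred B p} (P? : U.Decidable P) where

  map-filter : ∀ (f : A → B) xs → map f (filter (P? ∘ f) xs) ≡ filter P? (map f xs)
  map-filter f []       = refl
  map-filter f (x ∷ xs) with does (P? (f x))
  ... | true  = cong (f x ∷_) (map-filter f xs)
  ... | false = map-filter f xs

tabulate-lookup-fromList : ∀ {a} {A : Set a} (xs : List A) → tabulate (Vec.lookup (Vec.fromList xs)) ≡ xs
tabulate-lookup-fromList []       = refl
tabulate-lookup-fromList (x ∷ xs) = cong (x ∷_) (tabulate-lookup-fromList xs)

module _ {a p} {A : Set a} {P : Pred A p} (xs : List A) where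

  private
    at : Fin (length xs) → A
    at = Vec.lookup (Vec.fromList xs)

  All⇔∀-lookup-fromList : All P xs ⇔ (∀ i → P (at i))
  All⇔∀-lookup-fromList = mk⇔ (VecAll.lookup⁺ ∘ VecAll.fromList⁺) (VecAll.fromList⁻ ∘ VecAll.lookup⁻)

  length-filter-lookup-fromList : (P? : U.Decidable P) →
    length (filter (P? ∘ at) (allFin (length xs))) ≡ length (filter P? xs)
  length-filter-lookup-fromList P? = begin
    length (filter (P? ∘ at) (allFin _))       ≡⟨ length-map at (filter (P? ∘ at) (allFin _)) ⟨
    length (map at (filter (P? ∘ at) (allFin _))) ≡⟨ cong length (map-filter P? at (allFin _)) ⟩
    length (filter P? (map at (allFin _)))      ≡⟨ cong (length ∘ filter P?) (map-tabulate id at) ⟩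
    length (filter P? (tabulate at))            ≡⟨ cong (length ∘ filter P?) (tabulate-lookup-fromList xs) ⟩
    length (filter P? xs)                       ∎
    where open ≡-Reasoning

_≟φ_ : DecidableEquality ℤφ
_≟φ_ = ≡-dec ℤ._≟_ ℤ._≟_

*φ-comm : ∀ x y → x *φ y ≡ y *φ x
*φ-comm (a , b) (c , d) = cong₂ _,_
  (cong₂ ℤ._+_ (ℤ.*-comm a c) (ℤ.*-comm b d))
  (cong₂ ℤ._+_ (trans (ℤ.+-comm (a ℤ.* d) (b ℤ.* c)) (cong₂ ℤ._+_ (ℤ.*-comm b c) (ℤ.*-comm a d)))
               (ℤ.*-comm b d))

dot-comm : ∀ p q → dot p q ≡ dot q p
dot-comm (a₀ , a₁ , a₂ , a₃) (b₀ , b₁ , b₂ , b₃) =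
  cong₂ _+φ_ (cong₂ _+φ_ (cong₂ _+φ_ (*φ-comm a₀ b₀) (*φ-comm a₁ b₁)) (*φ-comm a₂ b₂)) (*φ-comm a₃ b₃)

Adjacent : Rel P4 _
Adjacent p q = dot p q ≡ (+ 0 , + 2)

adjacent? : Decidable Adjacent
adjacent? p q = dot p q ≟φ (+ 0 , + 2)

-- Quantifying over vertexList instead of over Fin 120 keeps pos from being
-- re-evaluated at every index, which is what makes these checks feasible.
∀-vertex? : ∀ {p} {P : Pred P4 p} → U.Decidable P → Dec (∀ v → P (pos v))
∀-vertex? P? = Dec.map (All⇔∀-lookup-fromList vertexList) (All.all? P? vertexList)

onSphere : ∀ v → dot (pos v) (pos v) ≡ (+ 4 , + 0)
onSphere = toWitness {a? = ∀-vertex? (λ p → dot p p ≟φ (+ 4 , + 0))} tt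

Adj-sym : Symmetric Adj
Adj-sym {u} {v} u~v = trans (dot-comm (pos v) (pos u)) u~v

Adj-irrefl : ∀ v → ¬ Adj v v
Adj-irrefl v v~v = 4≢2φ (trans (sym (onSphere v)) v~v)
  where
  4≢2φ : ¬ (+ 4 , + 0) ≡ (+ 0 , + 2)
  4≢2φ ()

adj? : Decidable Adj
adj? u v = adjacent? (pos u) (pos v)

open Packing Adj adj? (λ {u} {v} → Adj-sym {u} {v}) Adj-irrefl

degree≡12 : ∀ v → degree v ≡ 12
degree≡12 v = trans (length-filter-lookup-fromList vertexList (adjacent? (pos v))) (pointDegree v)
  where
  pointDegree : ∀ v → length (filter (adjacent? (pos v)) vertexList) ≡ 12
  pointDegree = toWitness {a? = ∀-vertex? (λ p → length (filter (adjacent? p) vertexList) ℕ.≟ 12)} tt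

noCommonNeighbour? : ∀ u v → Dec (¬ ∃ λ w → Adj u w × Adj w v)
noCommonNeighbour? u v =
  Dec.map′ uncurry curry (∀-vertex? (λ q → ¬? (adjacent? (pos u) q ×-dec adjacent? q (pos v))))

distance≥3? : Decidable DistAtLeast3
distance≥3? u v = ¬? (u Fin.≟ v) ×-dec ¬? (adj? u v) ×-dec noCommonNeighbour? u v

-- Indices of 2e₁, 2e₂, 2e₃, 2e₄, -2e₁, -2e₂ in vertexList.
S₆ : List Vertex
S₆ = # 0 ∷ # 1 ∷ # 2 ∷ # 3 ∷ # 4 ∷ # 5 ∷ []

S₆-dist3 : IsDist3Set S₆
S₆-dist3 = toWitness {a? = allPairs? distance≥3? S₆} tt

mainTheorem7 : (Σ (List Vertex) (λ S → IsDist3Set S × length S ≡ 6))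
                 × ((S : List Vertex) → IsDist3Set S → length S ≤ 9)
mainTheorem7 = (S₆ , S₆-dist3 , refl) , atMost9
  where
  atMost9 : (S : List Vertex) → IsDist3Set S → length S ≤ 9
  atMost9 S dist3 = ≤-pred (*-cancelʳ-< 13 (length S) 10
    (≤-<-trans (packing-bound (≤-reflexive ∘ sym ∘ degree≡12) dist3) (<ᵇ⇒< 120 130 _)))
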